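{- Let $P$ be a nominal set. If the functor $(-)^P:\mathbf{Nom}\to\mathbf{Nom}$ is finitary, then $P$ is orbit-finite.
   Context: $\mathbf{Nom}$ is the category of nominal sets (sets with an action of the group of finite permutations of a fixed infinite set $\mathbb V$ of atoms in which every element has a finite support) and equivariant maps. $X^P$ is the exponential in $\mathbf{Nom}$ (right adjoint to $(-)\times P$): the finitely supported maps $P\to X$ under $(\pi\star f)(y)=\pi\cdot f(\pi^{ -1}\cdot y)$. Finitary means preserving filtered colimits; orbit-finite means having finitely many orbits. -}

module Defs where

open import Level using (0ℓ)
open import Function using (_∘_)
open import Data.Nat using (ℕ)
open import Data.Fin using (Fin)
open import Data.List using (List; []; map; _++_)
open import Data.List.Membership.Propositional using (_∈_; _∉_)
open import Data.List.Membership.Propositional.Properties using (∈-++⁺ˡ; ∈-++⁺ʳ; ∈-map⁺)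
open import Data.Product using (Σ; _×_; _,_; proj₁; proj₂)
open import Relation.Binary.PropositionalEquality
  using (_≡_; refl; sym; trans; cong)
open import Relation.Binary.Bundles using (Setoid)
import Relation.Binary.Reasoning.Setoid as SetoidR

Atom : Set
Atom = ℕ

record FinPerm : Set where
  field
    fun     : Atom → Atom
    inv     : Atom → Atom
    inv-fun : ∀ a → inv (fun a) ≡ a
    fun-inv : ∀ a → fun (inv a) ≡ a
    supp    : List Atom
    fix     : ∀ a → a ∉ supp → fun a ≡ a

open FinPerm public

idP : FinPerm
idP = record
  { fun = λ a → a ; inv = λ a → a
  ; inv-fun = λ _ → refl ; fun-inv = λ _ → refl
  ; supp = [] ; fix = λ _ _ → refl }

_∘P_ : FinPerm → FinPerm → FinPerm
π ∘P σ = record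
  { fun = λ a → fun π (fun σ a)
  ; inv = λ a → inv σ (inv π a)
  ; inv-fun = λ a → trans (cong (inv σ) (inv-fun π (fun σ a))) (inv-fun σ a)
  ; fun-inv = λ a → trans (cong (fun π) (fun-inv σ (inv π a))) (fun-inv π a)
  ; supp = supp π ++ supp σ
  ; fix = λ a a∉ →
      trans (cong (fun π) (fix σ a (λ a∈ → a∉ (∈-++⁺ʳ (supp π) a∈))))
            (fix π a (λ a∈ → a∉ (∈-++⁺ˡ a∈)))
  }

_⁻¹P : FinPerm → FinPerm
π ⁻¹P = record
  { fun = inv π ; inv = fun π
  ; inv-fun = fun-inv π ; fun-inv = inv-fun π
  ; supp = supp π
  ; fix = λ a a∉ → trans (cong (inv π) (sym (fix π a a∉))) (inv-fun π a)
  }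

Fixes : FinPerm → List Atom → Set
Fixes σ A = ∀ a → a ∈ A → fun σ a ≡ a

record NominalSet : Set₁ where
  field
    S : Setoid 0ℓ 0ℓ
  open Setoid S public renaming (Carrier to Elt)
  infixr 6 _·_
  field
    _·_      : FinPerm → Elt → Elt
    act-cong : ∀ π {x y} → x ≈ y → π · x ≈ π · y
    act-ext  : ∀ {π σ} → (∀ a → fun π a ≡ fun σ a) → ∀ x → π · x ≈ σ · x
    act-id   : ∀ x → idP · x ≈ x
    act-comp : ∀ π σ x → (π ∘P σ) · x ≈ π · (σ · x)
    finsupp  : ∀ x → Σ (List Atom) λ A → ∀ σ → Fixes σ A → σ · x ≈ x

open NominalSet using (Elt)

record _⇒_ (X Y : NominalSet) : Set where
  private
    module X = NominalSet X
    module Y = NominalSet Y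
  field
    fn     : X.Elt → Y.Elt
    fn-cong : ∀ {x x'} → x X.≈ x' → fn x Y.≈ fn x'
    equiv  : ∀ π x → fn (π X.· x) Y.≈ π Y.· fn x

open _⇒_ public

-- The exponential X^P: finitely supported (setoid) maps P → X with
-- (π ⋆ f)(y) = π · f (π⁻¹ · y).

module _ (P X : NominalSet) where
  private
    module P = NominalSet P
    module X = NominalSet X

  record FSMap : Set where
    field
      app      : P.Elt → X.Elt
      app-cong : ∀ {y y'} → y P.≈ y' → app y X.≈ app y'
      app-supp : Σ (List Atom) λ A → ∀ σ → Fixes σ A →
                   ∀ y → σ X.· app ((σ ⁻¹P) P.· y) X.≈ app y

open FSMap public

inv-ext : ∀ {π σ} → (∀ a → fun π a ≡ fun σ a) → ∀ a → inv π a ≡ inv σ a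
inv-ext {π} {σ} e a =
  trans (cong (inv π) (sym (trans (e (inv σ a)) (fun-inv σ a))))
        (inv-fun π (inv σ a))

_^_ : NominalSet → NominalSet → NominalSet
X ^ P = record
  { S = record
      { Carrier = FSMap P X
      ; _≈_ = λ f g → ∀ y → app f y X.≈ app g y
      ; isEquivalence = record
          { refl = λ y → X.refl
          ; sym = λ e y → X.sym (e y)
          ; trans = λ e e' y → X.trans (e y) (e' y) } }
  ; _·_ = star
  ; act-cong = λ π e y → X.act-cong π (e _)
  ; act-ext = λ {π} {σ} e f y →
      X.trans (X.act-ext e _)
              (X.act-cong σ (app-cong f (P.act-ext (inv-ext {π} {σ} e) y)))
  ; act-id = λ f y → X.trans (X.act-id _) (app-cong f (P.act-id y))
  ; act-comp = λ π σ f y →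
      X.trans (X.act-comp π σ _)
        (X.act-cong π (X.act-cong σ (app-cong f (P.trans (P.act-ext (λ _ → refl) y) (P.act-comp (σ ⁻¹P) (π ⁻¹P) y)))))
  ; finsupp = λ f → supp' f
  }
  where
  module P = NominalSet P
  module X = NominalSet X

  star : FinPerm → FSMap P X → FSMap P X
  star π f = record
    { app = λ y → π X.· app f ((π ⁻¹P) P.· y)
    ; app-cong = λ e → X.act-cong π (app-cong f (P.act-cong (π ⁻¹P) e))
    ; app-supp = map (fun π) (proj₁ (app-supp f)) , prf
    }
    where
    A = proj₁ (app-supp f)
    hf = proj₂ (app-supp f)
    prf : ∀ σ → Fixes σ (map (fun π) A) → ∀ y →
          σ X.· (π X.· app f ((π ⁻¹P) P.· ((σ ⁻¹P) P.· y)))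
            X.≈ π X.· app f ((π ⁻¹P) P.· y)
    prf σ hσ y = begin
        σ X.· (π X.· w)        ≈⟨ X.sym (X.act-comp σ π w) ⟩
        (σ ∘P π) X.· w         ≈⟨ X.act-ext (λ a → sym (fun-inv π _)) w ⟩
        (π ∘P τ) X.· w         ≈⟨ X.act-comp π τ w ⟩
        π X.· (τ X.· w)        ≈⟨ X.act-cong π (X.act-cong τ (app-cong f inner)) ⟩
        π X.· (τ X.· app f ((τ ⁻¹P) P.· ((π ⁻¹P) P.· y)))
                               ≈⟨ X.act-cong π (hf τ τfix ((π ⁻¹P) P.· y)) ⟩
        π X.· app f ((π ⁻¹P) P.· y) ∎
      where
      open SetoidR X.S
      τ = (π ⁻¹P) ∘P (σ ∘P π)
      w = app f ((π ⁻¹P) P.· ((σ ⁻¹P) P.· y))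
      τfix : Fixes τ A
      τfix a a∈ = trans (cong (inv π) (hσ (fun π a) (∈-map⁺ (fun π) a∈)))
                        (inv-fun π a)
      inner : (π ⁻¹P) P.· ((σ ⁻¹P) P.· y) P.≈ (τ ⁻¹P) P.· ((π ⁻¹P) P.· y)
      inner = P.trans (P.sym (P.act-comp (π ⁻¹P) (σ ⁻¹P) y))
                (P.trans (P.act-ext (λ a → cong (inv π) (cong (inv σ) (sym (fun-inv π a)))) y)
                         (P.act-comp (τ ⁻¹P) (π ⁻¹P) y))

  supp' : ∀ f → Σ (List Atom) λ A → ∀ σ → Fixes σ A →
          ∀ y → app (star σ f) y X.≈ app f y
  supp' f = proj₁ (app-supp f) , proj₂ (app-supp f)

expMap : (P : NominalSet) {X Y : NominalSet} → X ⇒ Y → (X ^ P) ⇒ (Y ^ P)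
expMap P {X} {Y} h = record
  { fn = λ f → record
      { app = λ y → fn h (app f y)
      ; app-cong = λ e → fn-cong h (app-cong f e)
      ; app-supp = proj₁ (app-supp f) , λ σ hσ y →
          Y.trans (Y.sym (equiv h σ _)) (fn-cong h (proj₂ (app-supp f) σ hσ y))
      }
  ; fn-cong = λ e y → fn-cong h (e y)
  ; equiv = λ π f y → equiv h π _
  }
  where
  module Y = NominalSet Y

record Category : Set₁ where
  infixr 9 _∘C_
  field
    Obj   : Set
    Hom   : Obj → Obj → Set
    _≈h_  : ∀ {i j} → Hom i j → Hom i j → Set
    ≈h-refl  : ∀ {i j} {u : Hom i j} → u ≈h u
    ≈h-sym   : ∀ {i j} {u v : Hom i j} → u ≈h v → v ≈h u
    ≈h-trans : ∀ {i j} {u v w : Hom i j} → u ≈h v → v ≈h w → u ≈h w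
    idC   : ∀ {i} → Hom i i
    _∘C_  : ∀ {i j k} → Hom j k → Hom i j → Hom i k
    ∘-cong : ∀ {i j k} {u u' : Hom j k} {v v' : Hom i j} →
             u ≈h u' → v ≈h v' → (u ∘C v) ≈h (u' ∘C v')
    idˡ   : ∀ {i j} (u : Hom i j) → (idC ∘C u) ≈h u
    idʳ   : ∀ {i j} (u : Hom i j) → (u ∘C idC) ≈h u
    assoc : ∀ {i j k l} (u : Hom k l) (v : Hom j k) (w : Hom i j) →
            ((u ∘C v) ∘C w) ≈h (u ∘C (v ∘C w))

record Filtered (J : Category) : Set where
  open Category J
  field
    nonempty : Obj
    upper    : ∀ i j → Σ Obj λ k → Hom i k × Hom j k
    coequal  : ∀ {i j} (u v : Hom i j) →
               Σ Obj λ k → Σ (Hom j k) λ w → (w ∘C u) ≈h (w ∘C v)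

record Diagram (J : Category) : Set₁ where
  open Category J
  field
    D₀ : Obj → NominalSet
    D₁ : ∀ {i j} → Hom i j → D₀ i ⇒ D₀ j
    D-cong : ∀ {i j} {u v : Hom i j} → u ≈h v →
             ∀ x → NominalSet._≈_ (D₀ j) (fn (D₁ u) x) (fn (D₁ v) x)
    D-id   : ∀ {i} x → NominalSet._≈_ (D₀ i) (fn (D₁ (idC {i})) x) x
    D-comp : ∀ {i j k} (v : Hom j k) (u : Hom i j) x →
             NominalSet._≈_ (D₀ k) (fn (D₁ (v ∘C u)) x) (fn (D₁ v) (fn (D₁ u) x))

open Diagram public

record Cocone {J : Category} (D : Diagram J) : Set₁ where
  open Category J
  field
    apex : NominalSet
    leg  : ∀ i → D₀ D i ⇒ apex
    nat  : ∀ {i j} (u : Hom i j) x →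
           NominalSet._≈_ apex (fn (leg j) (fn (D₁ D u) x)) (fn (leg i) x)

open Cocone public

IsColimit : {J : Category} (D : Diagram J) → Cocone D → Set₁
IsColimit {J} D C = ∀ (C' : Cocone D) →
  Σ (apex C ⇒ apex C') λ m →
    (∀ i x → NominalSet._≈_ (apex C') (fn m (fn (leg C i) x)) (fn (leg C' i) x))
    × (∀ (m' : apex C ⇒ apex C') →
         (∀ i x → NominalSet._≈_ (apex C') (fn m' (fn (leg C i) x)) (fn (leg C' i) x)) →
         ∀ z → NominalSet._≈_ (apex C') (fn m' z) (fn m z))

expDiagram : (P : NominalSet) {J : Category} → Diagram J → Diagram J
expDiagram P D = record
  { D₀ = λ i → D₀ D i ^ P
  ; D₁ = λ u → expMap P (D₁ D u)
  ; D-cong = λ e f y → D-cong D e (app f y)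
  ; D-id = λ f y → D-id D (app f y)
  ; D-comp = λ v u f y → D-comp D v u (app f y)
  }

expCocone : (P : NominalSet) {J : Category} {D : Diagram J} → Cocone D →
            Cocone (expDiagram P D)
expCocone P C = record
  { apex = apex C ^ P
  ; leg = λ i → expMap P (leg C i)
  ; nat = λ u f y → nat C u (app f y)
  }

ExpFinitary : NominalSet → Set₁
ExpFinitary P = ∀ (J : Category) → Filtered J → (D : Diagram J) (C : Cocone D) →
  IsColimit D C → IsColimit (expDiagram P D) (expCocone P C)

OrbitFinite : NominalSet → Set
OrbitFinite P = Σ ℕ λ n → Σ (Fin n → Elt P) λ r →
  ∀ p → Σ (Fin n) λ i → Σ FinPerm λ π →
    NominalSet._≈_ P (NominalSet._·_ P π (r i)) p

module Submission where

-- Every nominal set P is the filtered colimit of its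
-- "orbit-finite pieces": index the diagram by finite lists rs of elements
-- of P, let the piece at rs consist of the elements lying in the orbit of
-- some member of rs, and let rs → rs' exist whenever each member of rs lies
-- in an orbit generated by rs'.  The legs are the inclusions into P.
--
-- If (-)^P is finitary, then P^P is the colimit of the pieces raised to P.
-- In any colimit in Nom every element comes from some leg, so the identity
-- map on P factors through a single piece rs: id = incl ∘ f.  Hence every
-- p ∈ P equals the first component of f p, which lies in the orbit of a
-- member of rs, and the finitely many members of rs represent all orbits.

open import Defs
open import Data.Fin using (Fin)
open import Data.Unit using (⊤; tt)
open import Data.List using (List; []; _∷_; _++_; length; lookup)
open import Data.List.Membership.Propositional using (_∈_)
open import Data.List.Membership.Propositional.Properties using (∈-++⁺ˡ; ∈-++⁺ʳ)
open import Data.List.Relation.Unary.Any using (here; index)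
open import Data.List.Relation.Unary.Any.Properties using (lookup-index)
open import Data.Product using (Σ; _×_; _,_; proj₁; proj₂)
import Relation.Binary.PropositionalEquality as Eq

idN : (X : NominalSet) → X ⇒ X
idN X = record { fn = λ x → x ; fn-cong = λ e → e ; equiv = λ π x → NominalSet.refl X }

_∘N_ : {X Y Z : NominalSet} → Y ⇒ Z → X ⇒ Y → X ⇒ Z
_∘N_ {Z = Z} g f = record
  { fn = λ x → fn g (fn f x)
  ; fn-cong = λ e → fn-cong g (fn-cong f e)
  ; equiv = λ π x → NominalSet.trans Z (fn-cong g (equiv f π x)) (equiv g π (fn f x))
  }

-- The union of the images of the legs is itself a cocone (elements are pairs
-- (i , x), compared via their image in the apex); the mediating map m into
-- it followed by the inclusion back into the apex is, by uniqueness of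
-- factorisations, the identity, so each z is the image of the pair m z.
module ColimitLegs {J : Category} (D : Diagram J) (C : Cocone D)
                   (isColim : IsColimit D C) where
  open Category J using (Obj)
  private
    module A = NominalSet (apex C)

    ι : ∀ i → NominalSet.Elt (D₀ D i) → A.Elt
    ι i = fn (leg C i)

    Image : NominalSet
    Image = record
      { S = record
          { Carrier = Σ Obj λ i → NominalSet.Elt (D₀ D i)
          ; _≈_ = λ (i , x) (j , y) → ι i x A.≈ ι j y
          ; isEquivalence = record { refl = A.refl ; sym = A.sym ; trans = A.trans } }
      ; _·_ = λ π (i , x) → i , NominalSet._·_ (D₀ D i) π x
      ; act-cong = λ π {(i , x)} {(j , y)} e →
          A.trans (equiv (leg C i) π x)
                  (A.trans (A.act-cong π e) (A.sym (equiv (leg C j) π y)))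
      ; act-ext = λ e (i , x) → fn-cong (leg C i) (NominalSet.act-ext (D₀ D i) e x)
      ; act-id = λ (i , x) → fn-cong (leg C i) (NominalSet.act-id (D₀ D i) x)
      ; act-comp = λ π σ (i , x) → fn-cong (leg C i) (NominalSet.act-comp (D₀ D i) π σ x)
      ; finsupp = λ (i , x) → let (A , fixes) = NominalSet.finsupp (D₀ D i) x in
          A , λ σ σA → fn-cong (leg C i) (fixes σ σA)
      }

    ImageCocone : Cocone D
    ImageCocone = record
      { apex = Image
      ; leg = λ i → record { fn = λ x → i , x ; fn-cong = fn-cong (leg C i)
                           ; equiv = λ π x → A.refl }
      ; nat = nat C
      }

    incl : Image ⇒ apex C
    incl = record { fn = λ (i , x) → ι i x ; fn-cong = λ e → e
                  ; equiv = λ π (i , x) → equiv (leg C i) π x }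

    mediate : apex C ⇒ Image
    mediate = proj₁ (isColim ImageCocone)

    -- both incl ∘ mediate and the identity factor C through itself
    factorisations-agree : ∀ z → fn (incl ∘N mediate) z A.≈ z
    factorisations-agree z =
      A.trans (unique (incl ∘N mediate) (proj₁ (proj₂ (isColim ImageCocone))) z)
              (A.sym (unique (idN (apex C)) (λ i x → A.refl) z))
      where unique = proj₂ (proj₂ (isColim C))

  jointly-surjective : ∀ z → Σ Obj λ i → Σ (NominalSet.Elt (D₀ D i)) λ x → ι i x A.≈ z
  jointly-surjective z = proj₁ (fn mediate z) , proj₂ (fn mediate z) , factorisations-agree z

module OrbitPieces (P : NominalSet) where
  open NominalSet P renaming (Elt to E)

  InOrbitOf : List E → E → Set
  InOrbitOf rs p = Σ E λ r → r ∈ rs × Σ FinPerm λ π → π · r ≈ p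

  Covered : List E → List E → Set
  Covered rs rs' = ∀ r → r ∈ rs → InOrbitOf rs' r

  transport : ∀ {rs rs'} → Covered rs rs' → ∀ {p} → InOrbitOf rs p → InOrbitOf rs' p
  transport h (r , r∈ , π , πr≈p) =
    let (r' , r'∈ , σ , σr'≈r) = h r r∈ in
    r' , r'∈ , π ∘P σ , trans (act-comp π σ r') (trans (act-cong π σr'≈r) πr≈p)

  act-inOrbit : ∀ {rs p} π → InOrbitOf rs p → InOrbitOf rs (π · p)
  act-inOrbit π (r , r∈ , σ , σr≈p) =
    r , r∈ , π ∘P σ , trans (act-comp π σ r) (act-cong π σr≈p)

  cong-inOrbit : ∀ {rs p q} → p ≈ q → InOrbitOf rs p → InOrbitOf rs q
  cong-inOrbit p≈q (r , r∈ , σ , σr≈p) = r , r∈ , σ , trans σr≈p p≈q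

  member-inOrbit : ∀ {rs r} → r ∈ rs → InOrbitOf rs r
  member-inOrbit {r = r} r∈ = r , r∈ , idP , act-id r

  Index : Category
  Index = record
    { Obj = List E
    ; Hom = Covered
    ; _≈h_ = λ _ _ → ⊤
    ; ≈h-refl = tt ; ≈h-sym = λ _ → tt ; ≈h-trans = λ _ _ → tt
    ; idC = λ r r∈ → member-inOrbit r∈
    ; _∘C_ = λ g f r r∈ → transport g (f r r∈)
    ; ∘-cong = λ _ _ → tt
    ; idˡ = λ _ → tt ; idʳ = λ _ → tt ; assoc = λ _ _ _ → tt
    }

  filtered : Filtered Index
  filtered = record
    { nonempty = []
    ; upper = λ rs rs' → rs ++ rs' , (λ r r∈ → member-inOrbit (∈-++⁺ˡ r∈))
                                   , (λ r r∈ → member-inOrbit (∈-++⁺ʳ rs r∈))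
    ; coequal = λ {_} {rs'} _ _ → rs' , (λ r r∈ → member-inOrbit r∈) , tt
    }

  Piece : List E → NominalSet
  Piece rs = record
    { S = record { Carrier = Σ E (InOrbitOf rs)
                 ; _≈_ = λ a b → proj₁ a ≈ proj₁ b
                 ; isEquivalence = record { refl = refl ; sym = sym ; trans = trans } }
    ; _·_ = λ π (p , o) → π · p , act-inOrbit π o
    ; act-cong = λ π e → act-cong π e
    ; act-ext = λ e a → act-ext e (proj₁ a)
    ; act-id = λ a → act-id (proj₁ a)
    ; act-comp = λ π σ a → act-comp π σ (proj₁ a)
    ; finsupp = λ a → finsupp (proj₁ a)
    }

  Pieces : Diagram Index
  Pieces = record
    { D₀ = Piece
    ; D₁ = λ h → record { fn = λ (p , o) → p , transport h o ; fn-cong = λ e → e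
                        ; equiv = λ π a → refl }
    ; D-cong = λ _ a → refl
    ; D-id = λ a → refl
    ; D-comp = λ _ _ a → refl
    }

  Inclusions : Cocone Pieces
  Inclusions = record
    { apex = P
    ; leg = λ rs → record { fn = proj₁ ; fn-cong = λ e → e ; equiv = λ π a → refl }
    ; nat = λ u a → refl
    }

  -- The mediating map into a cocone C' sends p to the leg of C' at the
  -- singleton piece [p]; every other piece containing p is reached from [p].
  inclusions-colimit : IsColimit Pieces Inclusions
  inclusions-colimit C' = mediate , commutes , unique
    where
    module A' = NominalSet (apex C')

    singleton : ∀ p → InOrbitOf (p ∷ []) p
    singleton p = member-inOrbit (here Eq.refl)

    atSingleton : E → A'.Elt
    atSingleton p = fn (leg C' (p ∷ [])) (p , singleton p)

    fromSingleton : ∀ {rs p} → InOrbitOf rs p → Covered (p ∷ []) rs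
    fromSingleton o _ (here Eq.refl) = o

    atSingleton-agrees : ∀ {rs p} (o : InOrbitOf rs p) →
                         atSingleton p A'.≈ fn (leg C' rs) (p , o)
    atSingleton-agrees {rs} {p} o =
      A'.trans (A'.sym (nat C' (fromSingleton o) (p , singleton p)))
               (fn-cong (leg C' rs) refl)

    mediate : P ⇒ apex C'
    mediate = record
      { fn = atSingleton
      ; fn-cong = λ {p} p≈q → A'.sym (A'.trans
          (atSingleton-agrees (cong-inOrbit p≈q (singleton p)))
          (fn-cong (leg C' (p ∷ [])) (sym p≈q)))
      ; equiv = λ π p → A'.trans (atSingleton-agrees (act-inOrbit π (singleton p)))
                                 (equiv (leg C' (p ∷ [])) π (p , singleton p))
      }

    commutes : ∀ rs a → atSingleton (proj₁ a) A'.≈ fn (leg C' rs) a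
    commutes rs (p , o) = atSingleton-agrees o

    unique : ∀ (m' : P ⇒ apex C') →
             (∀ rs a → fn m' (proj₁ a) A'.≈ fn (leg C' rs) a) →
             ∀ p → fn m' p A'.≈ atSingleton p
    unique m' h p = h (p ∷ []) (p , singleton p)

  orbitFinite-fromList : (rs : List E) → (∀ p → InOrbitOf rs p) → OrbitFinite P
  orbitFinite-fromList rs cover = length rs , lookup rs , representative
    where
    representative : ∀ p → Σ (Fin (length rs)) λ k → Σ FinPerm λ π → π · lookup rs k ≈ p
    representative p =
      let (r , r∈ , π , πr≈p) = cover p in
      index r∈ , π , trans (reflexive (Eq.cong (π ·_) (Eq.sym (lookup-index r∈)))) πr≈p

identityMap : (P : NominalSet) → NominalSet.Elt (P ^ P)
identityMap P = record
  { app = λ y → y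
  ; app-cong = λ e → e
  ; app-supp = [] , λ σ _ y →
      trans (sym (act-comp σ (σ ⁻¹P) y))
            (trans (act-ext {σ ∘P (σ ⁻¹P)} {idP} (fun-inv σ) y) (act-id y))
  }
  where open NominalSet P

-- Since (-)^P preserves the colimit P of its orbit pieces, the identity of
-- P comes from a single piece rs: a map f : P → Piece rs whose first
-- component is the identity.  The orbits of rs therefore cover P.
proposition5 : (P : NominalSet) → ExpFinitary P → OrbitFinite P
proposition5 P finitary = orbitFinite-fromList rs covers
  where
  open NominalSet P renaming (Elt to E)
  open OrbitPieces P

  expColimit : IsColimit (expDiagram P Pieces) (expCocone P Inclusions)
  expColimit = finitary Index filtered Pieces Inclusions inclusions-colimit

  identityFactors : Σ (List E) λ rs → Σ (FSMap P (Piece rs)) λ f →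
                      ∀ p → proj₁ (app f p) ≈ p
  identityFactors = ColimitLegs.jointly-surjective (expDiagram P Pieces)
                      (expCocone P Inclusions) expColimit (identityMap P)

  rs : List E
  rs = proj₁ identityFactors

  covers : ∀ p → InOrbitOf rs p
  covers p = let (_ , f , f≈id) = identityFactors in
             cong-inOrbit (f≈id p) (proj₂ (app f p))
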